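{- Let $n\ge 3$ and let $C_n$ be the cycle of order $n$. (i) If $S\in\mathcal{S}_{1,3,4,4}$, then $C_n$ is $\chi_S$-critical if and only if $n\in\{3,5,6,7,9\}$. (ii) If $S\in\mathcal{S}_{1,3,4,5}$, then $C_n$ is $\chi_S$-critical if and only if $n\in\{3,5,6,7,9,10,11,15,17,23\}$. (iii) If $S\in\mathcal{S}_{1,3,5,5}$, then $C_n$ is $\chi_S$-critical if and only if $n\in\{6,10\}$ or $n$ is odd.
   Context: A packing sequence is a non-decreasing infinite sequence $S=(s_1,s_2,\ldots)$ of positive integers. For a graph $G$, a map $\phi\colon V(G)\to\{1,\ldots,k\}$ is an $S$-packing $k$-coloring if any two distinct vertices $u,v$ with $\phi(u)=\phi(v)=i$ satisfy $d_G(u,v) > s_i$; $\chi_S(G)$ is the least such $k$. A graph $G$ is $\chi_S$-critical if $\chi_S(H)<\chi_S(G)$ for every proper subgraph $H$ of $G$. Notation: $\mathcal{S}_{a_1,\ldots,a_m}$ is the set of packing sequences with $s_j=a_j$ for all $j\le m$ (later entries arbitrary subject to being a packing sequence). E.g. $\mathcal{S}_{1,3,4,5}$: $s_1=1,s_2=3,s_3=4,s_4=5$. -}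

module Defs where

open import Data.Nat using (ℕ; zero; suc; _+_; _*_; _≤_; _<_; NonZero)
open import Data.Nat.DivMod using (_mod_)
open import Data.Fin using (Fin; toℕ)
open import Data.Bool using (Bool; true; false; T)
open import Data.Product using (Σ; ∃; _×_; _,_)
open import Data.Sum using (_⊎_)
open import Data.Empty using (⊥)
open import Relation.Nullary using (¬_)
open import Relation.Binary.PropositionalEquality using (_≡_; _≢_)

-- A packing sequence S = (s_1, s_2, ...), stored 1-indexed: s_i = seq i for i ≥ 1
-- (seq 0 is irrelevant and unused).
record PackingSeq : Set where
  field
    seq  : ℕ → ℕ
    pos  : ∀ i → 1 ≤ i → 1 ≤ seq i
    mono : ∀ i → 1 ≤ i → seq i ≤ seq (suc i)
open PackingSeq public

In𝒮 : ℕ → ℕ → ℕ → ℕ → PackingSeq → Set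
In𝒮 a b c d S = (seq S 1 ≡ a) × (seq S 2 ≡ b) × (seq S 3 ≡ c) × (seq S 4 ≡ d)

next : ∀ {n} → Fin n → Fin n
next {suc m} i = suc (toℕ i) mod suc m

-- The cycle C_n has vertex set Fin n and edges e_i = {i, i+1 mod n}, i ∈ Fin n
-- (for n ≥ 3 these are n distinct edges of a simple graph).
record SubC (n : ℕ) : Set where
  field
    vs    : Fin n → Bool
    es    : Fin n → Bool
    closed : ∀ i → T (es i) → T (vs i) × T (vs (next i))
open SubC public

fullC : ∀ n → SubC n
fullC n = record { vs = λ _ → true ; es = λ _ → true ; closed = λ _ _ → _ , _ }
  where open import Data.Unit using (tt)

Proper : ∀ {n} → SubC n → Set
Proper H = (∃ λ i → vs H i ≡ false) ⊎ (∃ λ i → es H i ≡ false)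

Adj : ∀ {n} → SubC n → Fin n → Fin n → Set
Adj H u v = ∃ λ i → T (es H i) × (((u ≡ i) × (v ≡ next i)) ⊎ ((v ≡ i) × (u ≡ next i)))

data Walk {n} (H : SubC n) : Fin n → Fin n → ℕ → Set where
  nil  : ∀ {u} → Walk H u u 0
  step : ∀ {u w v l} → Adj H u w → Walk H w v l → Walk H u v (suc l)

-- d_H(u,v) > s : there is no walk (hence no path) of length ≤ s from u to v in H.
DistGt : ∀ {n} → SubC n → Fin n → Fin n → ℕ → Set
DistGt H u v s = ∀ l → l ≤ s → ¬ Walk H u v l

-- An S-packing k-coloring of H: colours Fin k, colour c stands for colour
-- (toℕ c + 1) ∈ {1,…,k}, whose distance bound is s_{toℕ c + 1}.
PackingColoring : PackingSeq → ∀ {n} → SubC n → ℕ → Set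
PackingColoring S H k =
  Σ ((v : Fin _) → T (vs H v) → Fin k) λ φ →
    ∀ u v (hu : T (vs H u)) (hv : T (vs H v)) → u ≢ v → φ u hu ≡ φ v hv →
      DistGt H u v (seq S (suc (toℕ (φ u hu))))

IsChiS : PackingSeq → ∀ {n} → SubC n → ℕ → Set
IsChiS S H k = PackingColoring S H k × (∀ j → j < k → ¬ PackingColoring S H j)

Critical : PackingSeq → ℕ → Set
Critical S n = ∀ (H : SubC n) → Proper H →
  ∃ λ a → ∃ λ b → IsChiS S H a × IsChiS S (fullC n) b × a < b

{-# OPTIONS --safe #-}

-- Read around the cycle, a packing colouring of C_n is a cyclic word over ℕ in which colour c may
-- recur only at distance > s_(c+1). Here s_4 ≤ 5, so colours below 4 are constrained within windows
-- of six letters, and colours from 4 on are simply used once. Upper bounds on χ_S are explicit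
-- words; the infinite families start with 01020 and grow by inserting the block 010203, which keeps
-- every residue modulo 6 available. Lower bounds come from an exhaustive backtracking search over
-- such words whose completeness is proved. For odd cycles and s = (1,3,5,5) the search shows that the
-- zeros of a 4-colouring alternate, which is impossible around an odd cycle. A subgraph missing an
-- edge lies in a path on n vertices, so C_n is critical when all of these need fewer colours than C_n
-- and is not critical when the path obtained by deleting one edge needs as many.

module Submission where

open import Defs
open import Data.Bool using (Bool; true; false; T; not; _∧_; _∨_)
open import Data.Bool.Properties using (T-∧; T-∨; T-not-≡; not-involutive; not-¬)
open import Data.Bool.ListAction using (any; all)
open import Data.Empty using (⊥; ⊥-elim)
open import Data.Fin using (Fin; toℕ; fromℕ<; fromℕ; inject≤) renaming (zero to fzero; suc to fsuc)
open import Data.Fin.Properties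
  using (toℕ-injective; toℕ<n; toℕ-fromℕ<; toℕ-fromℕ; toℕ-inject≤; any?; all?) renaming (_≟_ to _≟ᶠ_)
open import Data.List using (List; []; _∷_; _++_; take; length; upTo)
open import Data.List.Membership.Propositional using (lose)
open import Data.List.Membership.Propositional.Properties using (∈-upTo⁺)
open import Data.List.Properties using (take-take; length-++; length-take; ++-identityʳ)
open import Data.List.Relation.Unary.Any.Properties using (any⁺)
open import Data.Nat
  using (ℕ; zero; suc; _+_; _*_; _∸_; _≤_; _<_; _⊓_; z≤n; s≤s; z<s; _≡ᵇ_; _<ᵇ_; _%_; _<?_)
open import Data.Nat.Divisibility using (divides; ∣-trans; n∣m*n)
open import Data.Nat.DivMod
  using (%-distribˡ-+; m%n%n≡m%n; [m+n]%n≡m%n; m%n<n; m%n≤m; m<n⇒m%n≡m; n%n≡0; %-remove-+ʳ)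
open import Data.Nat.Induction using (<-rec)
open import Data.Nat.Properties
open import Data.Product using (Σ; ∃; _×_; _,_; proj₁; proj₂)
open import Data.Sum using (_⊎_; inj₁; inj₂)
open import Data.Unit using (tt)
open import Data.Vec.Functional using (tail) renaming (_∷_ to _∷ᶠ_)
open import Function.Bundles using (Equivalence; _⇔_; mk⇔)
open import Relation.Binary.Definitions using (tri<; tri≈; tri>)
open import Relation.Binary.PropositionalEquality
open import Relation.Nullary using (Dec; yes; no; ¬_)
open import Relation.Nullary.Decidable using (T?; _×-dec_; _⊎-dec_; _→-dec_; ¬?; map′)

open Equivalence using (to; from)
open ≡-Reasoning

-- Words and their spacing

infixl 9 _!_
_!_ : List ℕ → ℕ → ℕ
[] ! _ = 0
(x ∷ xs) ! zero = x
(x ∷ xs) ! suc i = xs ! i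

!-++ˡ : ∀ L R x → x < length L → (L ++ R) ! x ≡ L ! x
!-++ˡ (a ∷ L) R zero _ = refl
!-++ˡ (a ∷ L) R (suc x) (s≤s x<L) = !-++ˡ L R x x<L

!-++ʳ : ∀ L R y → (L ++ R) ! (length L + y) ≡ R ! y
!-++ʳ [] R y = refl
!-++ʳ (a ∷ L) R y = !-++ʳ L R y

!-take : ∀ k L y → y < k → take k L ! y ≡ L ! y
!-take (suc k) [] y _ = refl
!-take (suc k) (a ∷ L) zero _ = refl
!-take (suc k) (a ∷ L) (suc y) (s≤s y<k) = !-take k L y y<k

all-! : ∀ p L j → T (all p L) → j < length L → T (p (L ! j))
all-! p (x ∷ L) zero h _ = proj₁ (to T-∧ h)
all-! p (x ∷ L) (suc j) h (s≤s j<L) = all-! p L j (proj₂ (to T-∧ h)) j<L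

Spaced : (ℕ → ℕ) → ℕ → (ℕ → ℕ) → ℕ → Set
Spaced req W w M = ∀ i t → 1 ≤ t → t ≤ W → i + t < M → w i ≡ w (i + t) → req (w i) < t

-- the letters of ys stand at distances d, d + 1, … after x
compatible : (ℕ → ℕ) → ℕ → List ℕ → ℕ → Bool
compatible req x [] d = true
compatible req x (y ∷ ys) d = (not (x ≡ᵇ y) ∨ (req x <ᵇ d)) ∧ compatible req x ys (suc d)

spaced : (ℕ → ℕ) → ℕ → List ℕ → Bool
spaced req W [] = true
spaced req W (x ∷ xs) = compatible req x (take W xs) 1 ∧ spaced req W xs

compatible-sound : ∀ req x W ys d j → j < W → j < length ys →
                   T (compatible req x (take W ys) d) → ys ! j ≡ x → req x < d + j
compatible-sound req x (suc W) (y ∷ ys) d zero _ _ h refl with to T-∨ (proj₁ (to T-∧ h))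
... | inj₁ x≢x = ⊥-elim (subst T (to T-not-≡ x≢x) (≡⇒≡ᵇ x x refl))
... | inj₂ r<d = subst (req x <_) (sym (+-identityʳ d)) (<ᵇ⇒< _ _ r<d)
compatible-sound req x (suc W) (y ∷ ys) d (suc j) (s≤s j<W) (s≤s j<ys) h e =
  subst (req x <_) (sym (+-suc d j)) (compatible-sound req x W ys (suc d) j j<W j<ys (proj₂ (to T-∧ h)) e)

spaced-sound : ∀ req W L → T (spaced req W L) → Spaced req W (L !_) (length L)
spaced-sound req W (x ∷ xs) h zero (suc t) _ t≤W (s≤s t<xs) e =
  compatible-sound req x W xs 1 t t≤W t<xs (proj₁ (to T-∧ h)) (sym e)
spaced-sound req W (x ∷ xs) h (suc i) t 1≤t t≤W (s≤s i+t<xs) e =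
  spaced-sound req W xs (proj₂ (to T-∧ h)) i t 1≤t t≤W i+t<xs e

revPrefix : (ℕ → ℕ) → ℕ → List ℕ
revPrefix w zero = []
revPrefix w (suc m) = w m ∷ revPrefix w m

revPrefix-! : ∀ w m j → j < m → revPrefix w m ! j ≡ w (m ∸ suc j)
revPrefix-! w (suc m) zero _ = refl
revPrefix-! w (suc m) (suc j) (s≤s j<m) = revPrefix-! w m j j<m

compatible-complete : ∀ req x w W k d →
                      (∀ j → j < W → j < k → w (k ∸ suc j) ≡ x → req x < d + j) →
                      T (compatible req x (take W (revPrefix w k)) d)
compatible-complete req x w zero k d h = tt
compatible-complete req x w (suc W) zero d h = tt
compatible-complete req x w (suc W) (suc k) d h = from T-∧ (head , rest)
  where
  head : T (not (x ≡ᵇ w k) ∨ (req x <ᵇ d))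
  head with x ≡ᵇ w k in eq
  ... | false = tt
  ... | true = <⇒<ᵇ (subst (req x <_) (+-identityʳ d) (h 0 z<s z<s (sym x≡wk)))
    where x≡wk = ≡ᵇ⇒≡ x (w k) (subst T (sym eq) tt)
  rest : T (compatible req x (take W (revPrefix w k)) (suc d))
  rest = compatible-complete req x w W k (suc d)
           (λ j j<W j<k e → subst (req x <_) (+-suc d j) (h (suc j) (s≤s j<W) (s≤s j<k) e))

compatible-at : ∀ req W w M m → Spaced req W w M → m < M →
                T (compatible req (w m) (take W (revPrefix w m)) 1)
compatible-at req W w M m sp m<M = compatible-complete req (w m) w W m 1 λ j j<W j<m e →
  let i+t≡m = m∸n+n≡m j<m
  in subst (λ c → req c < suc j) e
       (sp (m ∸ suc j) (suc j) (s≤s z≤n) j<W (subst (_< M) (sym i+t≡m) m<M)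
           (trans e (sym (cong w i+t≡m))))

-- Words are built backwards: acc holds the letters chosen so far, latest first, just as revPrefix w m
-- holds the first m letters of w.
search : (ℕ → ℕ) → ℕ → ℕ → (List ℕ → Bool) → ℕ → List ℕ → Bool
search req W K P zero acc = P acc
search req W K P (suc d) acc =
  any (λ c → compatible req c (take W acc) 1 ∧ search req W K P d (c ∷ acc)) (upTo K)

search-complete : ∀ req W K P w m d → Spaced req W w (m + d) → (∀ i → w i < K) →
                  T (P (revPrefix w (m + d))) → T (search req W K P d (revPrefix w m))
search-complete req W K P w m zero sp w<K hP = subst (λ k → T (P (revPrefix w k))) (+-identityʳ m) hP
search-complete req W K P w m (suc d) sp w<K hP =
  any⁺ _ (lose (∈-upTo⁺ (w<K m)) (from T-∧ (compatible-at req W w _ m sp (m<m+n m z<s) , deeper)))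
  where
  deeper : T (search req W K P d (revPrefix w (suc m)))
  deeper = search-complete req W K P w (suc m) d (subst (Spaced req W w) (+-suc m d) sp) w<K
             (subst (λ k → T (P (revPrefix w k))) (+-suc m d) hP)

compatible-take : ∀ req x k ys d → T (compatible req x ys d) → T (compatible req x (take k ys) d)
compatible-take req x zero ys d h = tt
compatible-take req x (suc k) [] d h = tt
compatible-take req x (suc k) (y ∷ ys) d h =
  from T-∧ (proj₁ (to T-∧ h) , compatible-take req x k ys (suc d) (proj₂ (to T-∧ h)))

spaced-mono : ∀ req {W′ W} L → W′ ≤ W → T (spaced req W L) → T (spaced req W′ L)
spaced-mono req [] W′≤W h = tt
spaced-mono req {W′} {W} (x ∷ xs) W′≤W h =
  from T-∧ (head , spaced-mono req xs W′≤W (proj₂ (to T-∧ h)))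
  where
  head : T (compatible req x (take W′ xs) 1)
  head = subst (λ ys → T (compatible req x ys 1))
           (trans (take-take W′ W xs) (cong (λ k → take k xs) (m≤n⇒m⊓n≡m W′≤W)))
           (compatible-take req x W′ (take W xs) 1 (proj₁ (to T-∧ h)))

take-++-take : ∀ k W (A B : List ℕ) → k ≤ W → take k (A ++ take W B) ≡ take k (A ++ B)
take-++-take k W [] B k≤W = trans (take-take k W B) (cong (λ j → take j B) (m≤n⇒m⊓n≡m k≤W))
take-++-take zero W (a ∷ A) B k≤W = refl
take-++-take (suc k) W (a ∷ A) B k≤W = cong (a ∷_) (take-++-take k W A B (≤-trans (n≤1+n k) k≤W))

spaced-++ : ∀ req W (A B : List ℕ) → T (spaced req W (A ++ take W B)) → T (spaced req W B) →
            T (spaced req W (A ++ B))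
spaced-++ req W [] B _ hB = hB
spaced-++ req W (a ∷ A) B hA hB =
  from T-∧ (subst (λ ys → T (compatible req a ys 1)) (take-++-take W W A B ≤-refl) (proj₁ (to T-∧ hA)) ,
            spaced-++ req W A B (proj₂ (to T-∧ hA)) hB)

spaced-suffix : ∀ req W (A B : List ℕ) → T (spaced req W (A ++ B)) → T (spaced req W B)
spaced-suffix req W [] B h = h
spaced-suffix req W (a ∷ A) B h = spaced-suffix req W A B (proj₂ (to T-∧ h))

Spaced-shift : ∀ req W w k M → Spaced req W w (M + k) → Spaced req W (λ j → w (j + k)) M
Spaced-shift req W w k M sp i t 1≤t t≤W i+t<M same =
  sp (i + k) t 1≤t t≤W (subst (_< M + k) (swap i t k) (+-monoˡ-< k i+t<M))
    (trans same (cong w (swap i t k)))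
  where
  swap : ∀ i t k → i + t + k ≡ i + k + t
  swap i t k = trans (+-assoc i t k) (trans (cong (i +_) (+-comm t k)) (sym (+-assoc i k t)))

onceFrom : ℕ → List ℕ → Bool
onceFrom h [] = true
onceFrom h (x ∷ xs) = ((x <ᵇ h) ∨ all (λ y → not (x ≡ᵇ y)) xs) ∧ onceFrom h xs

onceFrom-sound-< : ∀ h L i j → T (onceFrom h L) → i < j → j < length L →
                   L ! i ≡ L ! j → h ≤ L ! i → ⊥
onceFrom-sound-< h (x ∷ xs) zero (suc j) hL _ (s≤s j<xs) e h≤x with to T-∨ (proj₁ (to T-∧ hL))
... | inj₁ x<h = <⇒≱ (<ᵇ⇒< x h x<h) h≤x
... | inj₂ fresh = subst T (to T-not-≡ (all-! _ xs j fresh j<xs)) (≡⇒≡ᵇ x (xs ! j) e)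
onceFrom-sound-< h (x ∷ xs) (suc i) (suc j) hL (s≤s i<j) (s≤s j<xs) e h≤ =
  onceFrom-sound-< h xs i j (proj₂ (to T-∧ hL)) i<j j<xs e h≤

onceFrom-sound : ∀ h L i j → T (onceFrom h L) → i ≢ j → i < length L → j < length L →
                 L ! i ≡ L ! j → h ≤ L ! i → ⊥
onceFrom-sound h L i j hL i≢j i<L j<L e h≤ with <-cmp i j
... | tri< i<j _ _ = onceFrom-sound-< h L i j hL i<j j<L e h≤
... | tri≈ _ i≡j _ = i≢j i≡j
... | tri> _ _ j<i = onceFrom-sound-< h L j i hL j<i i<L (sym e) (subst (h ≤_) e h≤)

-- Walks on the cycle

Avoids : ∀ {n} → SubC n → Fin n → Set
Avoids H e = ∀ i → T (es H i) → i ≢ e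

module _ {m : ℕ} where
  private
    N = suc m

  %-absorbˡ : ∀ a b → (a % N + b) % N ≡ (a + b) % N
  %-absorbˡ a b = begin
    (a % N + b) % N          ≡⟨ %-distribˡ-+ (a % N) b N ⟩
    (a % N % N + b % N) % N  ≡⟨ cong (λ z → (z + b % N) % N) (m%n%n≡m%n a N) ⟩
    (a % N + b % N) % N      ≡⟨ %-distribˡ-+ a b N ⟨
    (a + b) % N              ∎

  %-absorbʳ : ∀ a b → (a + b % N) % N ≡ (a + b) % N
  %-absorbʳ a b = begin
    (a + b % N) % N  ≡⟨ cong (_% N) (+-comm a (b % N)) ⟩
    (b % N + a) % N  ≡⟨ %-absorbˡ b a ⟩
    (b + a) % N      ≡⟨ cong (_% N) (+-comm b a) ⟩
    (a + b) % N      ∎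

  suc-cong-% : ∀ a b → a % N ≡ b % N → suc a % N ≡ suc b % N
  suc-cong-% a b e = begin
    (1 + a) % N      ≡⟨ %-absorbʳ 1 a ⟨
    (1 + a % N) % N  ≡⟨ cong (λ z → (1 + z) % N) e ⟩
    (1 + b % N) % N  ≡⟨ %-absorbʳ 1 b ⟩
    (1 + b) % N      ∎

  -- adding m = N - 1 undoes a successor modulo N
  suc-cancel-% : ∀ a b → suc a % N ≡ suc b % N → a % N ≡ b % N
  suc-cancel-% a b e = begin
    a % N                ≡⟨ undo a ⟩
    (suc a % N + m) % N  ≡⟨ cong (λ z → (z + m) % N) e ⟩
    (suc b % N + m) % N  ≡⟨ undo b ⟨
    b % N                ∎
    where
    undo : ∀ a → a % N ≡ (suc a % N + m) % N
    undo a = sym (trans (%-absorbˡ (suc a) m) (trans (cong (_% N) (sym (+-suc a m))) ([m+n]%n≡m%n a N)))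

  +-cancelʳ-% : ∀ a b c → (a + c) % N ≡ (b + c) % N → a % N ≡ b % N
  +-cancelʳ-% a b zero e = subst₂ (λ x y → x % N ≡ y % N) (+-identityʳ a) (+-identityʳ b) e
  +-cancelʳ-% a b (suc c) e = +-cancelʳ-% a b c (suc-cancel-% (a + c) (b + c)
    (subst₂ (λ x y → x % N ≡ y % N) (+-suc a c) (+-suc b c) e))

  toℕ-next : ∀ (i : Fin N) → toℕ (next i) ≡ suc (toℕ i) % N
  toℕ-next i = toℕ-fromℕ< (m%n<n (suc (toℕ i)) N)

  toℕ-% : ∀ (i : Fin N) → toℕ i % N ≡ toℕ i
  toℕ-% i = m<n⇒m%n≡m (toℕ<n i)

  next-injective : ∀ (i j : Fin N) → next i ≡ next j → i ≡ j
  next-injective i j e = toℕ-injective (begin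
    toℕ i            ≡⟨ toℕ-% i ⟨
    toℕ i % N        ≡⟨ suc-cancel-% (toℕ i) (toℕ j) next≡ ⟩
    toℕ j % N        ≡⟨ toℕ-% j ⟩
    toℕ j            ∎)
    where
    next≡ = trans (sym (toℕ-next i)) (trans (cong toℕ e) (toℕ-next j))

  vertexAt : ℕ → Fin N
  vertexAt zero = Fin.zero
  vertexAt (suc k) = next (vertexAt k)

  toℕ-vertexAt : ∀ k → toℕ (vertexAt k) ≡ k % N
  toℕ-vertexAt zero = refl
  toℕ-vertexAt (suc k) = begin
    toℕ (next (vertexAt k))   ≡⟨ toℕ-next (vertexAt k) ⟩
    suc (toℕ (vertexAt k)) % N ≡⟨ cong (λ z → suc z % N) (toℕ-vertexAt k) ⟩
    (1 + k % N) % N           ≡⟨ %-absorbʳ 1 k ⟩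
    suc k % N                 ∎

  walk-displacement : ∀ {H : SubC N} {u v l} → Walk H u v l →
    Σ ℕ λ p → Σ ℕ λ q → (p + q ≡ l) × ((toℕ v + q) % N ≡ (toℕ u + p) % N)
  walk-displacement nil = 0 , 0 , refl , refl
  walk-displacement {u = u} {v} (step (_ , _ , inj₁ (refl , refl)) rest) with walk-displacement rest
  ... | p , q , p+q≡l , e = suc p , q , cong suc p+q≡l , (begin
    (toℕ v + q) % N            ≡⟨ e ⟩
    (toℕ (next u) + p) % N     ≡⟨ cong (λ z → (z + p) % N) (toℕ-next u) ⟩
    (suc (toℕ u) % N + p) % N  ≡⟨ %-absorbˡ (suc (toℕ u)) p ⟩
    (suc (toℕ u) + p) % N      ≡⟨ cong (_% N) (+-suc (toℕ u) p) ⟨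
    (toℕ u + suc p) % N        ∎)
  walk-displacement {v = v} (step {w = w} (_ , _ , inj₂ (refl , refl)) rest) with walk-displacement rest
  ... | p , q , p+q≡l , e = p , suc q , trans (+-suc p q) (cong suc p+q≡l) , (begin
    (toℕ v + suc q) % N        ≡⟨ cong (_% N) (+-suc (toℕ v) q) ⟩
    suc (toℕ v + q) % N        ≡⟨ suc-cong-% _ _ e ⟩
    suc (toℕ w + p) % N        ≡⟨ %-absorbˡ (suc (toℕ w)) p ⟨
    (suc (toℕ w) % N + p) % N  ≡⟨ cong (λ z → (z + p) % N) (toℕ-next w) ⟨
    (toℕ (next w) + p) % N     ∎)

  walk-offset : ∀ {H : SubC N} {u v l} → Walk H u v l →
    Σ ℕ λ t → t ≤ l × t < N × (toℕ v ≡ (toℕ u + t) % N ⊎ toℕ u ≡ (toℕ v + t) % N)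
  walk-offset {u = u} {v} {l} wk with walk-displacement wk
  ... | p , q , p+q≡l , e with ≤-total q p
  ... | inj₁ q≤p = (p ∸ q) % N , ≤-trans (m%n≤m (p ∸ q) N) (≤-trans (m∸n≤m p q) p≤l) ,
                   m%n<n (p ∸ q) N ,
                   inj₁ (begin
                     toℕ v                  ≡⟨ toℕ-% v ⟨
                     toℕ v % N              ≡⟨ +-cancelʳ-% (toℕ v) (toℕ u + (p ∸ q)) q v+q≡u+p ⟩
                     (toℕ u + (p ∸ q)) % N  ≡⟨ %-absorbʳ (toℕ u) (p ∸ q) ⟨
                     (toℕ u + (p ∸ q) % N) % N ∎)
    where
    p≤l : p ≤ l
    p≤l = subst (p ≤_) p+q≡l (m≤m+n p q)
    v+q≡u+p : (toℕ v + q) % N ≡ (toℕ u + (p ∸ q) + q) % N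
    v+q≡u+p = trans e (cong (_% N)
      (trans (cong (toℕ u +_) (sym (m∸n+n≡m q≤p))) (sym (+-assoc (toℕ u) (p ∸ q) q))))
  ... | inj₂ p≤q = (q ∸ p) % N , ≤-trans (m%n≤m (q ∸ p) N) (≤-trans (m∸n≤m q p) q≤l) ,
                   m%n<n (q ∸ p) N ,
                   inj₂ (begin
                     toℕ u                  ≡⟨ toℕ-% u ⟨
                     toℕ u % N              ≡⟨ +-cancelʳ-% (toℕ v + (q ∸ p)) (toℕ u) p v+q≡u+p ⟨
                     (toℕ v + (q ∸ p)) % N  ≡⟨ %-absorbʳ (toℕ v) (q ∸ p) ⟨
                     (toℕ v + (q ∸ p) % N) % N ∎)
    where
    q≤l : q ≤ l
    q≤l = subst (q ≤_) p+q≡l (m≤n+m q p)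
    v+q≡u+p : (toℕ v + (q ∸ p) + p) % N ≡ (toℕ u + p) % N
    v+q≡u+p = trans (cong (_% N)
      (trans (+-assoc (toℕ v) (q ∸ p) p) (cong (toℕ v +_) (m∸n+n≡m p≤q)))) e

  module _ (e : Fin N) where
    -- the position of v on the path from next e to e that remains when the edge e is deleted
    pathPos : Fin N → ℕ
    pathPos v = (toℕ v + (N ∸ toℕ (next e))) % N

    pathPos<N : ∀ v → pathPos v < N
    pathPos<N v = m%n<n (toℕ v + (N ∸ toℕ (next e))) N

    pathPos-injective : ∀ u v → pathPos u ≡ pathPos v → u ≡ v
    pathPos-injective u v eq =
      toℕ-injective (trans (sym (shift-back u)) (trans (cong (λ z → (z + r) % N) eq) (shift-back v)))
      where
      r = toℕ (next e)
      shift-back : ∀ v → (pathPos v + r) % N ≡ toℕ v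
      shift-back v = begin
        (pathPos v + r) % N             ≡⟨ %-absorbˡ (toℕ v + (N ∸ r)) r ⟩
        (toℕ v + (N ∸ r) + r) % N       ≡⟨ cong (_% N) (+-assoc (toℕ v) (N ∸ r) r) ⟩
        (toℕ v + ((N ∸ r) + r)) % N     ≡⟨ cong (λ z → (toℕ v + z) % N) (m∸n+n≡m (<⇒≤ (toℕ<n (next e)))) ⟩
        (toℕ v + N) % N                 ≡⟨ [m+n]%n≡m%n (toℕ v) N ⟩
        toℕ v % N                       ≡⟨ toℕ-% v ⟩
        toℕ v                           ∎

    pathPos-start : pathPos (next e) ≡ 0
    pathPos-start = trans (cong (_% N) (m+[n∸m]≡n (<⇒≤ (toℕ<n (next e))))) (n%n≡0 N)

    pathPos-next-% : ∀ i → pathPos (next i) ≡ suc (pathPos i) % N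
    pathPos-next-% i = begin
      (toℕ (next i) + (N ∸ toℕ (next e))) % N     ≡⟨ cong (λ z → (z + (N ∸ toℕ (next e))) % N) (toℕ-next i) ⟩
      (suc (toℕ i) % N + (N ∸ toℕ (next e))) % N  ≡⟨ %-absorbˡ (suc (toℕ i)) (N ∸ toℕ (next e)) ⟩
      suc (toℕ i + (N ∸ toℕ (next e))) % N        ≡⟨ %-absorbʳ 1 (toℕ i + (N ∸ toℕ (next e))) ⟨
      suc (pathPos i) % N                         ∎

    pathPos-next : ∀ i → i ≢ e → pathPos (next i) ≡ suc (pathPos i)
    pathPos-next i i≢e with m≤n⇒m<n∨m≡n (pathPos<N i)
    ... | inj₁ lt = trans (pathPos-next-% i) (m<n⇒m%n≡m lt)
    ... | inj₂ suc≡N = ⊥-elim (i≢e (next-injective i e (pathPos-injective (next i) (next e) (begin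
            pathPos (next i)     ≡⟨ pathPos-next-% i ⟩
            suc (pathPos i) % N  ≡⟨ cong (_% N) suc≡N ⟩
            N % N                ≡⟨ n%n≡0 N ⟩
            0                    ≡⟨ pathPos-start ⟨
            pathPos (next e)     ∎))))

  walk-pathPos : ∀ {H : SubC N} {e} → Avoids H e → ∀ {u v l} → Walk H u v l →
                 pathPos e v ≤ pathPos e u + l × pathPos e u ≤ pathPos e v + l
  walk-pathPos av nil = m≤m+n _ 0 , m≤m+n _ 0
  walk-pathPos {e = e} av {u} {v} (step {l = l} (i , hi , inj₁ (refl , refl)) rest)
    with walk-pathPos av rest
  ... | fwd , bwd =
    ≤-trans fwd (≤-reflexive (trans (cong (_+ l) u→) (sym (+-suc (pathPos e u) l)))) ,
    ≤-trans (n≤1+n _) (≤-trans (≤-reflexive (sym u→)) (≤-trans bwd (+-monoʳ-≤ (pathPos e v) (n≤1+n l))))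
    where u→ = pathPos-next e u (av u hi)
  walk-pathPos {e = e} av {u} {v} (step {w = w} {l = l} (i , hi , inj₂ (refl , refl)) rest)
    with walk-pathPos av rest
  ... | fwd , bwd =
    ≤-trans fwd (+-mono-≤ (≤-trans (n≤1+n _) (≤-reflexive (sym w→))) (n≤1+n l)) ,
    ≤-trans (≤-reflexive w→) (≤-trans (s≤s bwd) (≤-reflexive (sym (+-suc (pathPos e v) l))))
    where w→ = pathPos-next e w (av w hi)

-- Colourings read off words

wordColouring : ∀ (S : PackingSeq) {n} (H : SubC n) h K (L : List ℕ) (pos : Fin n → ℕ) →
  (∀ u v → pos u ≡ pos v → u ≡ v) → (∀ v → pos v < length L) →
  T (all (_<ᵇ K) L) → T (onceFrom h L) →
  (∀ u v → u ≢ v → L ! pos u ≡ L ! pos v → L ! pos u < h → DistGt H u v (seq S (suc (L ! pos u)))) →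
  PackingColoring S H K
wordColouring S H h K L pos pos-inj pos< colours once separated = (λ v _ → colour v) , colour-ok
  where
  colour : ∀ v → Fin K
  colour v = fromℕ< (<ᵇ⇒< _ K (all-! (_<ᵇ K) L (pos v) colours (pos< v)))
  toℕ-colour : ∀ v → toℕ (colour v) ≡ L ! pos v
  toℕ-colour v = toℕ-fromℕ< _
  same-letter : ∀ u v → colour u ≡ colour v → L ! pos u ≡ L ! pos v
  same-letter u v same = trans (sym (toℕ-colour u)) (trans (cong toℕ same) (toℕ-colour v))
  colour-ok : ∀ u v (hu : T (vs H u)) (hv : T (vs H v)) → u ≢ v → colour u ≡ colour v →
              DistGt H u v (seq S (suc (toℕ (colour u))))
  colour-ok u v _ _ u≢v same with L ! pos u <? h
  ... | yes low = subst (λ c → DistGt H u v (seq S (suc c))) (sym (toℕ-colour u))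
                    (separated u v u≢v (same-letter u v same) low)
  ... | no high = ⊥-elim (onceFrom-sound h L (pos u) (pos v) once (λ e → u≢v (pos-inj u v e)) (pos< u) (pos< v)
                    (same-letter u v same) (≮⇒≥ high))

module _ (W : ℕ) (L : List ℕ) {m : ℕ} (len : length L ≡ suc m) where
  private
    N = suc m

  wrap-length : length (L ++ take W L) ≡ N + W ⊓ N
  wrap-length = trans (length-++ L) (cong₂ _+_ len (trans (length-take W L) (cong (W ⊓_) len)))

  wrap-!ˡ : ∀ a → a < N → (L ++ take W L) ! a ≡ L ! a
  wrap-!ˡ a a<N = !-++ˡ L _ a (subst (a <_) (sym len) a<N)

  wrap-! : ∀ a t → a < N → t ≤ W ⊓ m →
           a + t < length (L ++ take W L) × (L ++ take W L) ! (a + t) ≡ L ! ((a + t) % N)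
  wrap-! a t a<N t≤ with a + t <? N
  ... | yes x<N = ≤-trans x<N (subst (N ≤_) (sym wrap-length) (m≤m+n N _)) ,
                  trans (wrap-!ˡ (a + t) x<N) (cong (L !_) (sym (m<n⇒m%n≡m x<N)))
  ... | no x≮N = subst (_< length (L ++ take W L)) x≡
                   (subst (N + y <_) (sym wrap-length) (+-monoʳ-< N y<W⊓N)) ,
                 (begin
                   (L ++ take W L) ! (a + t)         ≡⟨ cong ((L ++ take W L) !_) (sym x≡) ⟩
                   (L ++ take W L) ! (N + y)         ≡⟨ cong (λ k → (L ++ take W L) ! (k + y)) (sym len) ⟩
                   (L ++ take W L) ! (length L + y)  ≡⟨ !-++ʳ L (take W L) y ⟩
                   take W L ! y                      ≡⟨ !-take W L y (<-≤-trans y<W⊓N (m⊓n≤m W N)) ⟩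
                   L ! y                             ≡⟨ cong (L !_) (sym (m<n⇒m%n≡m y<N)) ⟩
                   L ! (y % N)                       ≡⟨ cong (L !_) (sym ([m+n]%n≡m%n y N)) ⟩
                   L ! ((y + N) % N)                 ≡⟨ cong (λ k → L ! (k % N)) (trans (+-comm y N) x≡) ⟩
                   L ! ((a + t) % N)                 ∎)
    where
    y = a + t ∸ N
    x≡ : N + y ≡ a + t
    x≡ = m+[n∸m]≡n (≮⇒≥ x≮N)
    y<t : y < t
    y<t = +-cancelˡ-< N y t (subst (_< N + t) (sym x≡) (+-monoˡ-< t a<N))
    y<W⊓N : y < W ⊓ N
    y<W⊓N = <-≤-trans y<t (≤-trans t≤ (⊓-monoʳ-≤ W (n≤1+n m)))
    y<N : y < N
    y<N = <-≤-trans y<W⊓N (m⊓n≤n W N)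

module _ (S : PackingSeq) (h : ℕ) (req : ℕ → ℕ) (W : ℕ)
         (S≤req : ∀ c → c < h → seq S (suc c) ≤ req c) (req≤W : ∀ c → c < h → req c ≤ W) where

  pathColouring : ∀ K (L : List ℕ) {m} (H : SubC (suc m)) e → Avoids H e → suc m ≤ length L →
                  T (all (_<ᵇ K) L) → T (onceFrom h L) → T (spaced req W L) → PackingColoring S H K
  pathColouring K L H e av N≤L colours once sp =
    wordColouring S H h K L (pathPos e) (pathPos-injective e) pos< colours once separated
    where
    pos< : ∀ v → pathPos e v < length L
    pos< v = <-≤-trans (pathPos<N e v) N≤L
    apart : ∀ i j l → i < j → j < length L → j ≤ i + l → L ! i ≡ L ! j → L ! i < h →
            l ≤ seq S (suc (L ! i)) → ⊥
    apart i j l i<j j<L j≤i+l eq low l≤s = <⇒≱ req<t (≤-trans t≤l (≤-trans l≤s (S≤req _ low)))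
      where
      i+t≡j = m+[n∸m]≡n (<⇒≤ i<j)
      t≤l : j ∸ i ≤ l
      t≤l = subst (j ∸ i ≤_) (m+n∸m≡n i l) (∸-monoˡ-≤ i j≤i+l)
      req<t : req (L ! i) < j ∸ i
      req<t = spaced-sound req W L sp i (j ∸ i) (m<n⇒0<n∸m i<j)
                (≤-trans t≤l (≤-trans l≤s (≤-trans (S≤req _ low) (req≤W _ low))))
                (subst (_< length L) (sym i+t≡j) j<L) (trans eq (cong (L !_) (sym i+t≡j)))
    separated : ∀ u v → u ≢ v → L ! pathPos e u ≡ L ! pathPos e v → L ! pathPos e u < h →
                DistGt H u v (seq S (suc (L ! pathPos e u)))
    separated u v u≢v eq low l l≤s wk with walk-pathPos av wk | <-cmp (pathPos e u) (pathPos e v)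
    ... | v≤u+l , _ | tri< u<v _ _ = apart _ _ l u<v (pos< v) v≤u+l eq low l≤s
    ... | _ | tri≈ _ same _ = u≢v (pathPos-injective e u v same)
    ... | _ , u≤v+l | tri> _ _ v<u =
      apart _ _ l v<u (pos< u) u≤v+l (sym eq) (subst (_< h) eq low)
        (subst (λ c → l ≤ seq S (suc c)) eq l≤s)

  -- The window is capped at m = n - 1, as a wider one would compare a letter of a short cycle with itself.
  cycleColouring : ∀ K (L : List ℕ) {m} → length L ≡ suc m → T (all (_<ᵇ K) L) → T (onceFrom h L) →
                   T (spaced req (W ⊓ m) (L ++ take W L)) → PackingColoring S (fullC (suc m)) K
  cycleColouring K L {m} len colours once sp =
    wordColouring S (fullC N) h K L toℕ (λ _ _ → toℕ-injective) pos< colours once separated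
    where
    N = suc m
    pos< : ∀ v → toℕ v < length L
    pos< v = subst (toℕ v <_) (sym len) (toℕ<n v)
    forward : ∀ (u v : Fin N) t → 1 ≤ t → t ≤ W ⊓ m → toℕ v ≡ (toℕ u + t) % N →
              L ! toℕ u ≡ L ! toℕ v → req (L ! toℕ u) < t
    forward u v t 1≤t t≤ v≡ eq with wrap-! W L len (toℕ u) t (toℕ<n u) t≤
    ... | in-range , at-t = subst (λ c → req c < t) here
          (spaced-sound req (W ⊓ m) (L ++ take W L) sp (toℕ u) t 1≤t t≤ in-range
            (trans here (trans eq (trans (cong (L !_) v≡) (sym at-t)))))
      where here = wrap-!ˡ W L len (toℕ u) (toℕ<n u)
    +0-% : ∀ (x : Fin N) → (toℕ x + 0) % N ≡ toℕ x
    +0-% x = trans (cong (_% N) (+-identityʳ (toℕ x))) (toℕ-% x)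
    offset-positive : ∀ (u v : Fin N) t → u ≢ v →
                      toℕ v ≡ (toℕ u + t) % N ⊎ toℕ u ≡ (toℕ v + t) % N → 1 ≤ t
    offset-positive u v zero u≢v (inj₁ v≡) = ⊥-elim (u≢v (toℕ-injective (sym (trans v≡ (+0-% u)))))
    offset-positive u v zero u≢v (inj₂ u≡) = ⊥-elim (u≢v (toℕ-injective (trans u≡ (+0-% v))))
    offset-positive u v (suc t) _ _ = s≤s z≤n
    separated : ∀ u v → u ≢ v → L ! toℕ u ≡ L ! toℕ v → L ! toℕ u < h →
                DistGt (fullC N) u v (seq S (suc (L ! toℕ u)))
    separated u v u≢v eq low l l≤s wk with walk-offset wk
    ... | t , t≤l , t<N , dir = <⇒≱ (req<t dir) t≤req
      where
      t≤req : t ≤ req (L ! toℕ u)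
      t≤req = ≤-trans t≤l (≤-trans l≤s (S≤req _ low))
      t≤ : t ≤ W ⊓ m
      t≤ = ⊓-glb (≤-trans t≤req (req≤W _ low)) (≤-pred t<N)
      req<t : toℕ v ≡ (toℕ u + t) % N ⊎ toℕ u ≡ (toℕ v + t) % N → req (L ! toℕ u) < t
      req<t (inj₁ v≡) = forward u v t (offset-positive u v t u≢v dir) t≤ v≡ eq
      req<t (inj₂ u≡) =
        subst (λ c → req c < t) (sym eq) (forward v u t (offset-positive u v t u≢v dir) t≤ u≡ (sym eq))

-- Words read off colourings

module _ (S : PackingSeq) {n : ℕ} (H : SubC n) {K : ℕ} (col : PackingColoring S H K)
         (v : ℕ → Fin n) (inH : ∀ k → T (vs H (v k))) where

  colourWord : ℕ → ℕ
  colourWord k = toℕ (proj₁ col (v k) (inH k))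

  colourWord<K : ∀ k → colourWord k < K
  colourWord<K k = toℕ<n _

  module _ (M : ℕ) (adj : ∀ k → suc k < M → Adj H (v k) (v (suc k))) where

    walkAlong : ∀ i t → i + t < M → Walk H (v i) (v (i + t)) t
    walkAlong i zero _ = subst (λ k → Walk H (v i) (v k) 0) (sym (+-identityʳ i)) nil
    walkAlong i (suc t) i+t<M = subst (λ k → Walk H (v i) (v k) (suc t)) (sym (+-suc i t))
      (step (adj i (<-≤-trans (s≤s (s≤s (m≤m+n i t))) i+t<M′)) (walkAlong (suc i) t i+t<M′))
      where i+t<M′ = subst (_< M) (+-suc i t) i+t<M

    colourWord-spaced : ∀ req W → (∀ c → c < K → req c ≤ seq S (suc c)) →
                        (∀ i t → 1 ≤ t → t ≤ W → i + t < M → v i ≢ v (i + t)) → Spaced req W colourWord M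
    colourWord-spaced req W req≤S distinct i t 1≤t t≤W i+t<M same =
      ≤-<-trans (req≤S _ (colourWord<K i)) (≰⇒> λ t≤s → far t t≤s (walkAlong i t i+t<M))
      where
      far = proj₂ col (v i) (v (i + t)) (inH i) (inH (i + t)) (distinct i t 1≤t t≤W i+t<M) (toℕ-injective same)

periodicᵇ : ℕ → ℕ → List ℕ → Bool
periodicᵇ n zero L = true
periodicᵇ n (suc j) L = (L ! j ≡ᵇ L ! (j + n)) ∧ periodicᵇ n j L

periodicᵇ-complete : ∀ n W w → (∀ x → w (x + n) ≡ w x) →
                     ∀ j → j ≤ W → T (periodicᵇ n j (revPrefix w (n + W)))
periodicᵇ-complete n W w per zero _ = tt
periodicᵇ-complete n W w per (suc j) j<W =
  from T-∧ (≡⇒≡ᵇ _ _ same , periodicᵇ-complete n W w per j (≤-trans (n≤1+n j) j<W))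
  where
  j+n<n+W : j + n < n + W
  j+n<n+W = ≤-trans (+-monoˡ-≤ n j<W) (≤-reflexive (+-comm W n))
  same : revPrefix w (n + W) ! j ≡ revPrefix w (n + W) ! (j + n)
  same = begin
    revPrefix w (n + W) ! j        ≡⟨ revPrefix-! w (n + W) j (≤-trans j<W (m≤n+m W n)) ⟩
    w (n + W ∸ suc j)              ≡⟨ cong w (trans (+-∸-assoc n j<W) (+-comm n (W ∸ suc j))) ⟩
    w (W ∸ suc j + n)              ≡⟨ per (W ∸ suc j) ⟩
    w (W ∸ suc j)                  ≡⟨ cong w ([m+n]∸[m+o]≡n∸o n W (suc j)) ⟨
    w (n + W ∸ (n + suc j))        ≡⟨ cong (λ k → w (n + W ∸ k)) (trans (+-suc n j) (cong suc (+-comm n j))) ⟩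
    w (n + W ∸ suc (j + n))        ≡⟨ revPrefix-! w (n + W) (j + n) j+n<n+W ⟨
    revPrefix w (n + W) ! (j + n)  ∎

pathC : ∀ n → SubC n
pathC n = record { vs = λ _ → true ; es = λ i → suc (toℕ i) <ᵇ n ; closed = λ _ _ → tt , tt }

module _ {m : ℕ} (S : PackingSeq) where
  private
    N = suc m

  module _ {K : ℕ} (col : PackingColoring S (fullC N) K) where
    cycleWord : ℕ → ℕ
    cycleWord = colourWord S (fullC N) col vertexAt (λ _ → tt)

    cycleWord-periodic : ∀ x → cycleWord (x + N) ≡ cycleWord x
    cycleWord-periodic x = cong (λ u → toℕ (proj₁ col u tt))
      (toℕ-injective (trans (toℕ-vertexAt (x + N)) (trans ([m+n]%n≡m%n x N) (sym (toℕ-vertexAt x)))))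

    cycleWord-spaced : ∀ req W → W < N → (∀ c → c < K → req c ≤ seq S (suc c)) →
                       ∀ M → Spaced req W cycleWord M
    cycleWord-spaced req W W<N req≤S M = colourWord-spaced S (fullC N) col vertexAt (λ _ → tt) M
      (λ k _ → vertexAt k , tt , inj₁ (refl , refl)) req W req≤S distinct
      where
      distinct : ∀ i t → 1 ≤ t → t ≤ W → i + t < M → vertexAt i ≢ vertexAt (i + t)
      distinct i t 1≤t t≤W _ same = <⇒≢ 1≤t (sym (begin
        t          ≡⟨ m<n⇒m%n≡m (≤-<-trans t≤W W<N) ⟨
        t % N      ≡⟨ +-cancelʳ-% t 0 i (begin
          (t + i) % N                ≡⟨ cong (_% N) (+-comm t i) ⟩
          (i + t) % N                ≡⟨ toℕ-vertexAt (i + t) ⟨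
          toℕ (vertexAt (i + t))     ≡⟨ cong toℕ same ⟨
          toℕ (vertexAt i)           ≡⟨ toℕ-vertexAt i ⟩
          i % N                      ∎) ⟩
        0          ∎))

  module _ {K : ℕ} (col : PackingColoring S (pathC N) K) where
    pathWord : ℕ → ℕ
    pathWord = colourWord S (pathC N) col vertexAt (λ _ → tt)

    pathWord-spaced : ∀ req W M → M ≤ N → (∀ c → c < K → req c ≤ seq S (suc c)) → Spaced req W pathWord M
    pathWord-spaced req W M M≤N req≤S =
      colourWord-spaced S (pathC N) col vertexAt (λ _ → tt) M adj req W req≤S distinct
      where
      toℕ-vertexAt< : ∀ k → k < N → toℕ (vertexAt k) ≡ k
      toℕ-vertexAt< k k<N = trans (toℕ-vertexAt k) (m<n⇒m%n≡m k<N)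
      adj : ∀ k → suc k < M → Adj (pathC N) (vertexAt k) (vertexAt (suc k))
      adj k k+1<M = vertexAt k , edge , inj₁ (refl , refl)
        where
        k+1<N = <-≤-trans k+1<M M≤N
        edge : T (suc (toℕ (vertexAt k)) <ᵇ N)
        edge = subst (λ j → T (suc j <ᵇ N)) (sym (toℕ-vertexAt< k (<-trans (n<1+n k) k+1<N))) (<⇒<ᵇ k+1<N)
      distinct : ∀ i t → 1 ≤ t → t ≤ W → i + t < M → vertexAt i ≢ vertexAt (i + t)
      distinct i t 1≤t _ i+t<M same = <⇒≢ (m<m+n i 1≤t) (begin
        i                      ≡⟨ toℕ-vertexAt< i (≤-<-trans (m≤m+n i t) i+t<N) ⟨
        toℕ (vertexAt i)       ≡⟨ cong toℕ same ⟩
        toℕ (vertexAt (i + t)) ≡⟨ toℕ-vertexAt< (i + t) i+t<N ⟩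
        i + t                  ∎)
        where i+t<N = <-≤-trans i+t<M M≤N

  -- read from vertex 0, a colouring of C_N is an N-periodic word, spaced for every window below N
  noCycleColouring : ∀ req D K → (∀ c → c < K → req c ≤ seq S (suc c)) →
                     search req (D ⊓ m) K (periodicᵇ N (D ⊓ m)) (N + D ⊓ m) [] ≡ false →
                     ¬ PackingColoring S (fullC N) K
  noCycleColouring req D K req≤S fails col = subst T fails
    (search-complete req W K (periodicᵇ N W) (cycleWord col) 0 (N + W)
       (cycleWord-spaced col req W (s≤s (m⊓n≤n D m)) req≤S (N + W))
       (colourWord<K S (fullC N) col vertexAt _)
       (periodicᵇ-complete N W (cycleWord col) (cycleWord-periodic col) W ≤-refl))
    where W = D ⊓ m

  noPathColouring : ∀ req W K M → M ≤ N → (∀ c → c < K → req c ≤ seq S (suc c)) →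
                    search req W K (λ _ → true) M [] ≡ false → ¬ PackingColoring S (pathC N) K
  noPathColouring req W K M M≤N req≤S fails col = subst T fails
    (search-complete req W K (λ _ → true) (pathWord col) 0 M (pathWord-spaced col req W M M≤N req≤S)
       (colourWord<K S (pathC N) col vertexAt _) tt)

-- Chromatic numbers and criticality

module _ {n : ℕ} (H : SubC n) where
  adj? : ∀ u w → Dec (Adj H u w)
  adj? u w = any? λ i → T? (es H i) ×-dec (((u ≟ᶠ i) ×-dec (w ≟ᶠ next i)) ⊎-dec ((w ≟ᶠ i) ×-dec (u ≟ᶠ next i)))

  walk? : ∀ u v l → Dec (Walk H u v l)
  walk? u v zero with u ≟ᶠ v
  ... | yes refl = yes nil
  ... | no u≢v = no λ { nil → u≢v refl }
  walk? u v (suc l) with any? (λ w → adj? u w ×-dec walk? w v l)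
  ... | yes (w , a , wk) = yes (step a wk)
  ... | no none = no λ { (step a wk) → none (_ , a , wk) }

  distGt? : ∀ u v s → Dec (DistGt H u v s)
  distGt? u v s = map′ (λ f l l≤s → f (s≤s l≤s)) (λ g {l} l<1+s → g l (≤-pred l<1+s))
                       (allUpTo? (λ l → ¬? (walk? u v l)) (suc s))

∃-function? : ∀ n {k} (Q : (Fin n → Fin k) → Set) → (∀ f g → (∀ i → f i ≡ g i) → Q f → Q g) →
              (∀ f → Dec (Q f)) → Dec (Σ (Fin n → Fin k) Q)
∃-function? zero Q resp Q? with Q? (λ ())
... | yes q = yes (_ , q)
... | no ¬q = no λ { (f , q) → ¬q (resp f _ (λ ()) q) }
∃-function? (suc n) Q resp Q? with any? (λ a → ∃-function? n (λ g → Q (a ∷ᶠ g))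
                                     (λ f g f≗g → resp (a ∷ᶠ f) (a ∷ᶠ g) λ { fzero → refl ; (fsuc i) → f≗g i })
                                     (λ g → Q? (a ∷ᶠ g)))
... | yes (a , g , q) = yes (a ∷ᶠ g , q)
... | no none = no λ { (f , q) → none (f fzero , tail f , resp f _ (λ { fzero → refl ; (fsuc i) → refl }) q) }

module _ (S : PackingSeq) {n : ℕ} (H : SubC n) where
  Separated : ∀ {k} → (Fin n → Fin k) → Set
  Separated ψ = ∀ u v → T (vs H u) → T (vs H v) → u ≢ v → ψ u ≡ ψ v → DistGt H u v (seq S (suc (toℕ (ψ u))))

  separated-resp : ∀ {k} (f g : Fin n → Fin k) → (∀ i → f i ≡ g i) → Separated f → Separated g
  separated-resp f g f≗g sep u v hu hv u≢v same = subst (λ c → DistGt H u v (seq S (suc (toℕ c)))) (f≗g u)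
    (sep u v hu hv u≢v (trans (f≗g u) (trans same (sym (f≗g v)))))

  separated? : ∀ {k} (ψ : Fin n → Fin k) → Dec (Separated ψ)
  separated? ψ = all? λ u → all? λ v → T? (vs H u) →-dec (T? (vs H v) →-dec (¬? (u ≟ᶠ v) →-dec
                   ((ψ u ≟ᶠ ψ v) →-dec distGt? H u v _)))

  -- a colouring only needs values on the vertices of H; elsewhere it is padded with colour 0
  packingColoring? : ∀ K → Dec (PackingColoring S H K)
  packingColoring? zero with all? (λ v → ¬? (T? (vs H v)))
  ... | yes empty = yes ((λ v hv → ⊥-elim (empty v hv)) , (λ u _ hu _ _ _ → ⊥-elim (empty u hu)))
  ... | no nonempty = no λ { (φ , _) → nonempty (λ v hv → no-colour (φ v hv)) }
    where
    no-colour : Fin 0 → ⊥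
    no-colour ()
  packingColoring? (suc k) = map′ partial total (∃-function? n Separated separated-resp separated?)
    where
    partial : Σ (Fin n → Fin (suc k)) Separated → PackingColoring S H (suc k)
    partial (ψ , sep) = (λ v _ → ψ v) , sep
    pad : ∀ b → (T b → Fin (suc k)) → Fin (suc k)
    pad true f = f tt
    pad false f = fzero
    pad-eq : ∀ b (f : T b → Fin (suc k)) (hb : T b) → pad b f ≡ f hb
    pad-eq true f hb = refl
    total : PackingColoring S H (suc k) → Σ (Fin n → Fin (suc k)) Separated
    total (φ , sep) = ψ , λ u v hu hv u≢v same →
      subst (λ c → DistGt H u v (seq S (suc (toℕ c)))) (sym (pad-eq _ (φ u) hu))
        (sep u v hu hv u≢v (trans (sym (pad-eq _ (φ u) hu)) (trans same (pad-eq _ (φ v) hv))))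
      where
      ψ : Fin n → Fin (suc k)
      ψ v = pad (vs H v) (φ v)

  PackingColoring-mono : ∀ {j k} → j ≤ k → PackingColoring S H j → PackingColoring S H k
  PackingColoring-mono j≤k (φ , sep) = (λ v hv → inject≤ (φ v hv) j≤k) , λ u v hu hv u≢v same →
    subst (λ c → DistGt H u v (seq S (suc c))) (sym (toℕ-inject≤ (φ u hu) j≤k))
      (sep u v hu hv u≢v (toℕ-injective (trans (sym (toℕ-inject≤ (φ u hu) j≤k))
        (trans (cong toℕ same) (toℕ-inject≤ (φ v hv) j≤k)))))

module _ {P : ℕ → Set} (P? : ∀ j → Dec (P j)) where
  Least : ℕ → Set
  Least a = P a × ∀ j → j < a → ¬ P j

  least : ∀ K → P K → Σ ℕ λ a → Least a × a ≤ K
  least = <-rec (λ K → P K → Σ ℕ λ a → Least a × a ≤ K) go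
    where
    go : ∀ K → (∀ {j} → j < K → P j → Σ ℕ λ a → Least a × a ≤ j) → P K → Σ ℕ λ a → Least a × a ≤ K
    go K below pK with anyUpTo? P? K
    ... | yes (j , j<K , pj) with below j<K pj
    ...   | a , least-a , a≤j = a , least-a , ≤-trans a≤j (<⇒≤ j<K)
    go K below pK | no none = K , (pK , λ j j<K pj → none (j , j<K , pj)) , ≤-refl

proper⇒avoids : ∀ {n} (H : SubC n) → Proper H → ∃ (Avoids H)
proper⇒avoids H (inj₁ (x , x∉H)) =
  x , λ i i∈H i≡x → subst T x∉H (subst (λ z → T (vs H z)) i≡x (proj₁ (closed H i i∈H)))
proper⇒avoids H (inj₂ (x , x∉H)) =
  x , λ i i∈H i≡x → subst T x∉H (subst (λ z → T (es H z)) i≡x i∈H)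

pathC-proper : ∀ m → Proper (pathC (suc m))
pathC-proper m = inj₂ (fromℕ m , trans (cong (λ z → suc z <ᵇ suc m) (toℕ-fromℕ m)) (n<ᵇn m))
  where
  n<ᵇn : ∀ n → (n <ᵇ n) ≡ false
  n<ᵇn zero = refl
  n<ᵇn (suc n) = n<ᵇn n

module _ (S : PackingSeq) where
  critical : ∀ {n} b → PackingColoring S (fullC n) (suc b) → ¬ PackingColoring S (fullC n) b →
             (∀ H e → Avoids H e → PackingColoring S H b) → Critical S n
  critical {n} b colourable not-colourable colour-avoiding H proper with proper⇒avoids H proper
  ... | e , avoids with least (packingColoring? S H) b (colour-avoiding H e avoids)
  ... | a , (pa , below) , a≤b = a , suc b , (pa , below) , (colourable , fewer) , s≤s a≤b
    where
    fewer : ∀ j → j < suc b → ¬ PackingColoring S (fullC n) j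
    fewer j (s≤s j≤b) pj = not-colourable (PackingColoring-mono S (fullC n) j≤b pj)

  nonCritical : ∀ {m} c → PackingColoring S (fullC (suc m)) (suc c) → ¬ PackingColoring S (pathC (suc m)) c →
                ¬ Critical S (suc m)
  nonCritical {m} c colourable path-not-colourable crit with crit (pathC (suc m)) (pathC-proper m)
  ... | a , b , (pa , _) , (_ , below) , a<b with c <? a
  ...   | yes c<a = below (suc c) (≤-trans (s≤s c<a) a<b) colourable
  ...   | no c≮a = path-not-colourable (PackingColoring-mono S (pathC (suc m)) (≮⇒≥ c≮a) pa)

-- requirement a b c d k is the distance requirement s_(k+1) of colour k for S ∈ 𝒮_{a,b,c,d}; colours
-- k ≥ 4 get d, a lower bound for their unknown s_(k+1) that is only ever used as such.
requirement : ℕ → ℕ → ℕ → ℕ → ℕ → ℕ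
requirement a b c d zero = a
requirement a b c d (suc zero) = b
requirement a b c d (suc (suc zero)) = c
requirement a b c d (suc (suc (suc _))) = d

requirement-mono : ∀ {a b c d a′ b′ c′ d′} → a ≤ a′ → b ≤ b′ → c ≤ c′ → d ≤ d′ →
                   ∀ k → requirement a b c d k ≤ requirement a′ b′ c′ d′ k
requirement-mono a≤ _ _ _ zero = a≤
requirement-mono _ b≤ _ _ (suc zero) = b≤
requirement-mono _ _ c≤ _ (suc (suc zero)) = c≤
requirement-mono _ _ _ d≤ (suc (suc (suc _))) = d≤

module _ {a b c d : ℕ} (S : PackingSeq) (S∈ : In𝒮 a b c d S) where
  private
    s₁ = proj₁ S∈
    s₂ = proj₁ (proj₂ S∈)
    s₃ = proj₁ (proj₂ (proj₂ S∈))
    s₄ = proj₂ (proj₂ (proj₂ S∈))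

  seq≤requirement : ∀ k → k < 4 → seq S (suc k) ≤ requirement a b c d k
  seq≤requirement zero _ = ≤-reflexive s₁
  seq≤requirement (suc zero) _ = ≤-reflexive s₂
  seq≤requirement (suc (suc zero)) _ = ≤-reflexive s₃
  seq≤requirement (suc (suc (suc zero))) _ = ≤-reflexive s₄
  seq≤requirement (suc (suc (suc (suc _)))) (s≤s (s≤s (s≤s (s≤s ()))))

  requirement≤seq : ∀ k → requirement a b c d k ≤ seq S (suc k)
  requirement≤seq zero = ≤-reflexive (sym s₁)
  requirement≤seq (suc zero) = ≤-reflexive (sym s₂)
  requirement≤seq (suc (suc zero)) = ≤-reflexive (sym s₃)
  requirement≤seq (suc (suc (suc k))) = ≤-trans (≤-reflexive (sym s₄)) (from4 k)
    where
    from4 : ∀ k → seq S 4 ≤ seq S (4 + k)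
    from4 zero = ≤-refl
    from4 (suc k) = ≤-trans (from4 k) (mono S (4 + k) (s≤s z≤n))

reqA reqB reqC : ℕ → ℕ
reqA = requirement 1 3 4 4
reqB = requirement 1 3 4 5
reqC = requirement 1 3 5 5

reqA≤reqB : ∀ c → reqA c ≤ reqB c
reqA≤reqB = requirement-mono ≤-refl ≤-refl ≤-refl (n≤1+n 4)

reqB≤reqC : ∀ c → reqB c ≤ reqC c
reqB≤reqC = requirement-mono ≤-refl ≤-refl (n≤1+n 4) ≤-refl

reqA≤reqC : ∀ c → reqA c ≤ reqC c
reqA≤reqC c = ≤-trans (reqA≤reqB c) (reqB≤reqC c)

reqC≤5 : ∀ c → reqC c ≤ 5
reqC≤5 zero = s≤s z≤n
reqC≤5 (suc zero) = s≤s (s≤s (s≤s z≤n))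
reqC≤5 (suc (suc zero)) = ≤-refl
reqC≤5 (suc (suc (suc _))) = ≤-refl

-- Words of period 6

P5 X6 : List ℕ
P5 = 0 ∷ 1 ∷ 0 ∷ 2 ∷ 0 ∷ []
X6 = 0 ∷ 1 ∷ 0 ∷ 2 ∷ 0 ∷ 3 ∷ []

-- (010203)^a 01020 rest: since every such word begins with 01020, prepending 010203 creates no new
-- conflict beyond those already present in 010203 01020
repeated : ℕ → List ℕ → List ℕ
repeated zero rest = P5 ++ rest
repeated (suc a) rest = X6 ++ repeated a rest

length-repeated : ∀ a rest → length (repeated a rest) ≡ length (P5 ++ rest) + a * 6
length-repeated zero rest = sym (+-identityʳ _)
length-repeated (suc a) rest = begin
  6 + length (repeated a rest)  ≡⟨ cong (6 +_) (length-repeated a rest) ⟩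
  6 + (n + a * 6)               ≡⟨ +-assoc 6 n (a * 6) ⟨
  (6 + n) + a * 6               ≡⟨ cong (_+ a * 6) (+-comm 6 n) ⟩
  (n + 6) + a * 6               ≡⟨ +-assoc n 6 (a * 6) ⟩
  n + (6 + a * 6)               ∎
  where
  n = length (P5 ++ rest)

take-repeated : ∀ a rest → take 5 (repeated a rest) ≡ P5
take-repeated zero rest = refl
take-repeated (suc a) rest = refl

repeated-colours : ∀ k a rest → T (all (_<ᵇ 4 + k) rest) → T (all (_<ᵇ 4 + k) (repeated a rest))
repeated-colours k zero rest h = h
repeated-colours k (suc a) rest h = repeated-colours k a rest h

repeated-once : ∀ a rest → T (onceFrom 4 rest) → T (onceFrom 4 (repeated a rest))
repeated-once zero rest h = h
repeated-once (suc a) rest h = repeated-once a rest h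

repeated-spaced : ∀ req tail → T (spaced req 5 (X6 ++ P5)) →
                  ∀ rest → T (spaced req 5 (P5 ++ rest ++ tail)) →
                  ∀ a → T (spaced req 5 (repeated a rest ++ tail))
repeated-spaced req tail X6-ok rest base zero = base
repeated-spaced req tail X6-ok rest base (suc a) =
  spaced-++ req 5 X6 (repeated a rest ++ tail) (junction a) (repeated-spaced req tail X6-ok rest base a)
  where
  junction : ∀ a → T (spaced req 5 (X6 ++ take 5 (repeated a rest ++ tail)))
  junction zero = X6-ok
  junction (suc a) = X6-ok

module Certificates (S : PackingSeq) (lower upper : ℕ → ℕ)
                    (lower≤S : ∀ c → lower c ≤ seq S (suc c))
                    (S≤upper : ∀ c → c < 4 → seq S (suc c) ≤ upper c)
                    (upper≤reqC : ∀ c → upper c ≤ reqC c)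
                    (X6-spaced : T (spaced upper 5 (X6 ++ P5))) where
  private
    upper≤5 : ∀ c → c < 4 → upper c ≤ 5
    upper≤5 c _ = ≤-trans (upper≤reqC c) (reqC≤5 c)

  cycle : ∀ K (L : List ℕ) {m} → length L ≡ suc m → T (all (_<ᵇ K) L) → T (onceFrom 4 L) →
          T (spaced upper (5 ⊓ m) (L ++ take 5 L)) → PackingColoring S (fullC (suc m)) K
  cycle = cycleColouring S 4 upper 5 S≤upper upper≤5

  path : ∀ K (L : List ℕ) {m} → suc m ≤ length L → T (all (_<ᵇ K) L) → T (onceFrom 4 L) →
         T (spaced upper 5 L) → ∀ H e → Avoids H e → PackingColoring S H K
  path K L N≤L colours once sp H e avoids =
    pathColouring S 4 upper 5 S≤upper upper≤5 K L H e avoids N≤L colours once sp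

  noCycle : ∀ K {m} → search lower (5 ⊓ m) K (periodicᵇ (suc m) (5 ⊓ m)) (suc m + 5 ⊓ m) [] ≡ false →
            ¬ PackingColoring S (fullC (suc m)) K
  noCycle K = noCycleColouring S lower 5 K (λ c _ → lower≤S c)

  noPath : ∀ K M {m} → M ≤ suc m → search lower 5 K (λ _ → true) M [] ≡ false →
           ¬ PackingColoring S (pathC (suc m)) K
  noPath K M M≤N = noPathColouring S lower 5 K M M≤N (λ c _ → lower≤S c)

  cycleFamily : ∀ {k} rest → T (all (_<ᵇ 4 + k) rest) → T (onceFrom 4 rest) →
                T (spaced upper 5 (P5 ++ rest ++ P5)) →
                ∀ a → PackingColoring S (fullC (length (P5 ++ rest) + a * 6)) (4 + k)
  cycleFamily {k} rest colours once sp a =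
    cycle (4 + k) L (length-repeated a rest) (repeated-colours k a rest colours) (repeated-once a rest once)
      (spaced-mono upper (L ++ take 5 L) (m⊓n≤m 5 _)
        (subst (λ ys → T (spaced upper 5 (L ++ ys))) (sym (take-repeated a rest))
          (repeated-spaced upper P5 X6-spaced rest sp a)))
    where
    L = repeated a rest

  avoiding⇒4-colourable : ∀ {m} H e → Avoids H e → PackingColoring S {suc m} H 4
  avoiding⇒4-colourable {m} = path 4 L N≤L (repeated-colours 0 m [] tt) (repeated-once m [] tt)
    (subst (λ L → T (spaced upper 5 L)) (++-identityʳ L) (repeated-spaced upper [] X6-spaced [] P5-spaced m))
    where
    L = repeated m []
    N≤L : suc m ≤ length L
    N≤L = subst (suc m ≤_) (sym (length-repeated m [])) (s≤s (≤-trans (m≤m*n m 6) (m≤n+m _ 4)))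
    P5-spaced : T (spaced upper 5 P5)
    P5-spaced = spaced-suffix upper 5 X6 P5 X6-spaced

-- Odd cycles need five colours for S ∈ 𝒮_{1,3,5,5}

bothNonzero : List ℕ → Bool
bothNonzero L = not (L ! 4 ≡ᵇ 0) ∧ not (L ! 5 ≡ᵇ 0)

-- The search finds no reqC-spaced 4-colour word of length 8 whose third and fourth letters are both nonzero.
zeros-alternate : ∀ (w : ℕ → ℕ) → (∀ i → w i < 4) → Spaced reqC 5 w 8 → (w 2 ≡ᵇ 0) ≡ not (w 3 ≡ᵇ 0)
zeros-alternate w w<4 sp with w 2 ≡ᵇ 0 in e₂ | w 3 ≡ᵇ 0 in e₃
... | true | true = ⊥-elim (<-irrefl refl (subst (λ c → reqC c < 1) w₂≡0
                       (sp 2 1 ≤-refl (s≤s z≤n) (s≤s (s≤s (s≤s (s≤s z≤n)))) (trans w₂≡0 (sym w₃≡0)))))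
  where
  w₂≡0 = ≡ᵇ⇒≡ (w 2) 0 (subst T (sym e₂) tt)
  w₃≡0 = ≡ᵇ⇒≡ (w 3) 0 (subst T (sym e₃) tt)
... | true | false = refl
... | false | true = refl
... | false | false = ⊥-elim (subst T no-window (search-complete reqC 5 4 bothNonzero w 0 8 sp w<4 both))
  where
  no-window : search reqC 5 4 bothNonzero 8 [] ≡ false
  no-window = refl
  both : T (bothNonzero (revPrefix w 8))
  both = subst₂ (λ x y → T (not x ∧ not y)) (sym e₃) (sym e₂) tt

odd-alternation : ∀ (b : ℕ → Bool) → (∀ k → b (suc k) ≡ not (b k)) → ∀ n → n % 2 ≡ 1 → b n ≡ not (b 0)
odd-alternation b flip (suc zero) _ = flip 0
odd-alternation b flip (suc (suc n)) odd = begin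
  b (2 + n)        ≡⟨ flip (suc n) ⟩
  not (b (1 + n))  ≡⟨ cong not (flip n) ⟩
  not (not (b n))  ≡⟨ not-involutive (b n) ⟩
  b n              ≡⟨ odd-alternation b flip n odd ⟩
  not (b 0)        ∎

oddCycle-not-4-colourable : ∀ (S : PackingSeq) → (∀ c → reqC c ≤ seq S (suc c)) →
                            ∀ {m} → 5 < suc m → suc m % 2 ≡ 1 → ¬ PackingColoring S (fullC (suc m)) 4
oddCycle-not-4-colourable S reqC≤S {m} 5<N odd col =
  not-¬ refl (trans (sym periodic) (odd-alternation zero-at flip (suc m) odd))
  where
  w = cycleWord S col
  zero-at : ℕ → Bool
  zero-at k = w (2 + k) ≡ᵇ 0
  flip : ∀ k → zero-at (suc k) ≡ not (zero-at k)
  flip k = sym (trans (cong not alternate) (not-involutive _))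
    where
    window-spaced = Spaced-shift reqC 5 w k 8 (cycleWord-spaced S col reqC 5 5<N (λ c _ → reqC≤S c) (8 + k))
    alternate = zeros-alternate (λ j → w (j + k)) (λ j → colourWord<K S (fullC (suc m)) col vertexAt _ (j + k))
                  window-spaced
  periodic : zero-at (suc m) ≡ zero-at 0
  periodic = cong (_≡ᵇ 0) (cycleWord-periodic S col 2)

module Common (S : PackingSeq) (reqA≤S : ∀ c → reqA c ≤ seq S (suc c))
              (S≤reqC : ∀ c → c < 4 → seq S (suc c) ≤ reqC c) where
  open Certificates S reqA reqC reqA≤S S≤reqC (λ _ → ≤-refl) tt public

  critical-3 : Critical S 3
  critical-3 = critical S 2 (cycle 3 (0 ∷ 1 ∷ 2 ∷ []) refl tt tt tt) (noCycle 2 refl)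
                 (path 2 (0 ∷ 1 ∷ 0 ∷ []) ≤-refl tt tt tt)

  critical-5 : Critical S 5
  critical-5 = critical S 3 (cycle 4 (0 ∷ 1 ∷ 0 ∷ 2 ∷ 3 ∷ []) refl tt tt tt) (noCycle 3 refl)
                 (path 3 (0 ∷ 1 ∷ 0 ∷ 2 ∷ 0 ∷ []) ≤-refl tt tt tt)

  critical-6 : Critical S 6
  critical-6 = critical S 3 (cycle 4 (0 ∷ 1 ∷ 0 ∷ 2 ∷ 0 ∷ 3 ∷ []) refl tt tt tt) (noCycle 3 refl)
                 (path 3 (0 ∷ 1 ∷ 0 ∷ 2 ∷ 0 ∷ 1 ∷ []) ≤-refl tt tt tt)

  critical-7 : Critical S 7
  critical-7 = critical S 4 (cycle 5 (0 ∷ 1 ∷ 0 ∷ 2 ∷ 0 ∷ 3 ∷ 4 ∷ []) refl tt tt tt) (noCycle 4 refl)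
                 avoiding⇒4-colourable

  critical-9 : Critical S 9
  critical-9 = critical S 4 (cycle 5 (0 ∷ 1 ∷ 0 ∷ 2 ∷ 0 ∷ 1 ∷ 0 ∷ 3 ∷ 4 ∷ []) refl tt tt tt) (noCycle 4 refl)
                 avoiding⇒4-colourable

  ¬critical-4 : ¬ Critical S 4
  ¬critical-4 = nonCritical S 2 (cycle 3 (0 ∷ 1 ∷ 0 ∷ 2 ∷ []) refl tt tt tt) (noPath 2 4 ≤-refl refl)

  ¬critical-if-4-colourable : ∀ {m} → 8 ≤ suc m → PackingColoring S (fullC (suc m)) 4 → ¬ Critical S (suc m)
  ¬critical-if-4-colourable 8≤N col = nonCritical S 3 col (noPath 3 8 8≤N refl)

  ¬critical-8+6a : ∀ a → ¬ Critical S (8 + a * 6)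
  ¬critical-8+6a a = ¬critical-if-4-colourable (m≤m+n 8 _) (cycleFamily (1 ∷ 0 ∷ 3 ∷ []) tt tt tt a)

  ¬critical-12+6a : ∀ a → ¬ Critical S (12 + a * 6)
  ¬critical-12+6a a = ¬critical-if-4-colourable (m≤m+n 8 _)
    (cycleFamily (3 ∷ 0 ∷ 1 ∷ 0 ∷ 2 ∷ 0 ∷ 3 ∷ []) tt tt tt a)

  ¬critical-16+6a : ∀ a → ¬ Critical S (16 + a * 6)
  ¬critical-16+6a a = ¬critical-if-4-colourable (m≤m+n 8 _)
    (cycleFamily (1 ∷ 0 ∷ 3 ∷ 0 ∷ 1 ∷ 0 ∷ 2 ∷ 0 ∷ 1 ∷ 0 ∷ 3 ∷ []) tt tt tt a)

  fiveColouring-7+6a : ∀ a → PackingColoring S (fullC (7 + a * 6)) 5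
  fiveColouring-7+6a = cycleFamily (3 ∷ 4 ∷ []) tt tt tt

  fiveColouring-9+6a : ∀ a → PackingColoring S (fullC (9 + a * 6)) 5
  fiveColouring-9+6a = cycleFamily (1 ∷ 0 ∷ 3 ∷ 4 ∷ []) tt tt tt

  fiveColouring-17+6a : ∀ a → PackingColoring S (fullC (17 + a * 6)) 5
  fiveColouring-17+6a = cycleFamily (1 ∷ 0 ∷ 3 ∷ 0 ∷ 1 ∷ 0 ∷ 2 ∷ 0 ∷ 1 ∷ 0 ∷ 3 ∷ 4 ∷ []) tt tt tt

  fiveColouring-10 : PackingColoring S (fullC 10) 5
  fiveColouring-10 = cycle 5 (0 ∷ 1 ∷ 0 ∷ 2 ∷ 0 ∷ 1 ∷ 0 ∷ 3 ∷ 0 ∷ 4 ∷ []) refl tt tt tt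

module CommonAB (S : PackingSeq) (reqA≤S : ∀ c → reqA c ≤ seq S (suc c))
                (S≤reqB : ∀ c → c < 4 → seq S (suc c) ≤ reqB c) where
  open Common S reqA≤S (λ c c<4 → ≤-trans (S≤reqB c c<4) (reqB≤reqC c)) public
  private
    module B = Certificates S reqA reqB reqA≤S S≤reqB reqB≤reqC tt

  ¬critical-13+6a : ∀ a → ¬ Critical S (13 + a * 6)
  ¬critical-13+6a a = ¬critical-if-4-colourable (m≤m+n 8 _)
    (B.cycleFamily (1 ∷ 3 ∷ 0 ∷ 2 ∷ 0 ∷ 1 ∷ 0 ∷ 3 ∷ []) tt tt tt a)

  ¬critical-21+6a : ∀ a → ¬ Critical S (21 + a * 6)
  ¬critical-21+6a a = ¬critical-if-4-colourable (m≤m+n 8 _)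
    (B.cycleFamily (1 ∷ 0 ∷ 3 ∷ 0 ∷ 1 ∷ 0 ∷ 2 ∷ 0 ∷ 1 ∷ 3 ∷ 0 ∷ 2 ∷ 0 ∷ 1 ∷ 0 ∷ 3 ∷ []) tt tt tt a)

-- Classification

data ModSix : ℕ → Set where
  3+6×_ : ∀ a → ModSix (3 + a * 6)
  4+6×_ : ∀ a → ModSix (4 + a * 6)
  5+6×_ : ∀ a → ModSix (5 + a * 6)
  6+6×_ : ∀ a → ModSix (6 + a * 6)
  7+6×_ : ∀ a → ModSix (7 + a * 6)
  8+6×_ : ∀ a → ModSix (8 + a * 6)

modSix : ∀ n → 3 ≤ n → ModSix n
modSix 1 (s≤s ())
modSix 2 (s≤s (s≤s ()))
modSix 3 _ = 3+6× 0
modSix 4 _ = 4+6× 0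
modSix 5 _ = 5+6× 0
modSix 6 _ = 6+6× 0
modSix 7 _ = 7+6× 0
modSix 8 _ = 8+6× 0
modSix (suc (suc (suc (suc (suc (suc (suc (suc (suc n))))))))) _ =
  add6 (modSix (suc (suc (suc n))) (s≤s (s≤s (s≤s z≤n))))
  where
  add6 : ∀ {n} → ModSix n → ModSix (6 + n)
  add6 (3+6× a) = 3+6× suc a
  add6 (4+6× a) = 4+6× suc a
  add6 (5+6× a) = 5+6× suc a
  add6 (6+6× a) = 6+6× suc a
  add6 (7+6× a) = 7+6× suc a
  add6 (8+6× a) = 8+6× suc a

+6×-parity : ∀ r a → (r + a * 6) % 2 ≡ r % 2
+6×-parity r a = %-remove-+ʳ r (∣-trans (divides 3 refl) (n∣m*n a))

module PartA (S : PackingSeq) (S∈ : In𝒮 1 3 4 4 S) where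
  open CommonAB S (requirement≤seq S S∈) (λ c c<4 → ≤-trans (seq≤requirement S S∈ c c<4) (reqA≤reqB c))
  private
    module A = Certificates S reqA reqA (requirement≤seq S S∈) (seq≤requirement S S∈) reqA≤reqC tt

  ¬critical-10 : ¬ Critical S 10
  ¬critical-10 = ¬critical-if-4-colourable (m≤m+n 8 _)
    (A.cycle 4 (0 ∷ 1 ∷ 0 ∷ 2 ∷ 3 ∷ 0 ∷ 1 ∷ 0 ∷ 2 ∷ 3 ∷ []) refl tt tt tt)

  ¬critical-15 : ¬ Critical S 15
  ¬critical-15 = ¬critical-if-4-colourable (m≤m+n 8 _)
    (A.cycle 4 (0 ∷ 1 ∷ 0 ∷ 2 ∷ 3 ∷ 0 ∷ 1 ∷ 0 ∷ 2 ∷ 3 ∷ 0 ∷ 1 ∷ 0 ∷ 2 ∷ 3 ∷ []) refl tt tt tt)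

  ¬critical-11+6a : ∀ a → ¬ Critical S (11 + a * 6)
  ¬critical-11+6a a = ¬critical-if-4-colourable (m≤m+n 8 _)
    (A.cycleFamily (3 ∷ 0 ∷ 1 ∷ 0 ∷ 2 ∷ 3 ∷ []) tt tt tt a)

  Listed : ℕ → Set
  Listed n = n ≡ 3 ⊎ n ≡ 5 ⊎ n ≡ 6 ⊎ n ≡ 7 ⊎ n ≡ 9

  listed : ∀ {n} → ModSix n → Critical S n → Listed n
  listed (3+6× 0) _ = inj₁ refl
  listed (3+6× 1) _ = inj₂ (inj₂ (inj₂ (inj₂ refl)))
  listed (3+6× 2) c = ⊥-elim (¬critical-15 c)
  listed (3+6× suc (suc (suc a))) c = ⊥-elim (¬critical-21+6a a c)
  listed (4+6× 0) c = ⊥-elim (¬critical-4 c)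
  listed (4+6× 1) c = ⊥-elim (¬critical-10 c)
  listed (4+6× suc (suc a)) c = ⊥-elim (¬critical-16+6a a c)
  listed (5+6× 0) _ = inj₂ (inj₁ refl)
  listed (5+6× suc a) c = ⊥-elim (¬critical-11+6a a c)
  listed (6+6× 0) _ = inj₂ (inj₂ (inj₁ refl))
  listed (6+6× suc a) c = ⊥-elim (¬critical-12+6a a c)
  listed (7+6× 0) _ = inj₂ (inj₂ (inj₂ (inj₁ refl)))
  listed (7+6× suc a) c = ⊥-elim (¬critical-13+6a a c)
  listed (8+6× a) c = ⊥-elim (¬critical-8+6a a c)

  critical-listed : ∀ {n} → Listed n → Critical S n
  critical-listed (inj₁ refl) = critical-3
  critical-listed (inj₂ (inj₁ refl)) = critical-5
  critical-listed (inj₂ (inj₂ (inj₁ refl))) = critical-6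
  critical-listed (inj₂ (inj₂ (inj₂ (inj₁ refl)))) = critical-7
  critical-listed (inj₂ (inj₂ (inj₂ (inj₂ refl)))) = critical-9

  classification : ∀ n → 3 ≤ n → Critical S n ⇔ Listed n
  classification n 3≤n = mk⇔ (listed (modSix n 3≤n)) critical-listed

module PartB (S : PackingSeq) (S∈ : In𝒮 1 3 4 5 S) where
  open CommonAB S (λ c → ≤-trans (reqA≤reqB c) (requirement≤seq S S∈ c)) (seq≤requirement S S∈)
  private
    module B = Certificates S reqB reqB (requirement≤seq S S∈) (seq≤requirement S S∈) reqB≤reqC tt

  critical-10 : Critical S 10
  critical-10 = critical S 4 fiveColouring-10 (B.noCycle 4 refl) avoiding⇒4-colourable

  critical-11 : Critical S 11
  critical-11 = critical S 4 (B.cycle 5 (0 ∷ 1 ∷ 0 ∷ 2 ∷ 0 ∷ 1 ∷ 0 ∷ 3 ∷ 0 ∷ 2 ∷ 4 ∷ []) refl tt tt tt)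
                  (B.noCycle 4 refl) avoiding⇒4-colourable

  critical-15 : Critical S 15
  critical-15 = critical S 4 (fiveColouring-9+6a 1) (B.noCycle 4 refl) avoiding⇒4-colourable

  critical-17 : Critical S 17
  critical-17 = critical S 4 (fiveColouring-17+6a 0) (B.noCycle 4 refl) avoiding⇒4-colourable

  critical-23 : Critical S 23
  critical-23 = critical S 4 (fiveColouring-17+6a 1) (B.noCycle 4 refl) avoiding⇒4-colourable

  ¬critical-29+6a : ∀ a → ¬ Critical S (29 + a * 6)
  ¬critical-29+6a a = ¬critical-if-4-colourable (m≤m+n 8 _) (B.cycleFamily
    (1 ∷ 0 ∷ 3 ∷ 0 ∷ 1 ∷ 0 ∷ 2 ∷ 0 ∷ 1 ∷ 0 ∷ 3 ∷ 0 ∷ 1 ∷ 0 ∷ 2 ∷ 0 ∷ 1 ∷ 3 ∷ 0 ∷ 2 ∷ 0 ∷ 1 ∷ 0 ∷ 3 ∷ [])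
    tt tt tt a)

  Listed : ℕ → Set
  Listed n = n ≡ 3 ⊎ n ≡ 5 ⊎ n ≡ 6 ⊎ n ≡ 7 ⊎ n ≡ 9 ⊎ n ≡ 10 ⊎ n ≡ 11 ⊎ n ≡ 15 ⊎ n ≡ 17 ⊎ n ≡ 23

  listed : ∀ {n} → ModSix n → Critical S n → Listed n
  listed (3+6× 0) _ = inj₁ refl
  listed (3+6× 1) _ = inj₂ (inj₂ (inj₂ (inj₂ (inj₁ refl))))
  listed (3+6× 2) _ = inj₂ (inj₂ (inj₂ (inj₂ (inj₂ (inj₂ (inj₂ (inj₁ refl)))))))
  listed (3+6× suc (suc (suc a))) c = ⊥-elim (¬critical-21+6a a c)
  listed (4+6× 0) c = ⊥-elim (¬critical-4 c)
  listed (4+6× 1) _ = inj₂ (inj₂ (inj₂ (inj₂ (inj₂ (inj₁ refl)))))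
  listed (4+6× suc (suc a)) c = ⊥-elim (¬critical-16+6a a c)
  listed (5+6× 0) _ = inj₂ (inj₁ refl)
  listed (5+6× 1) _ = inj₂ (inj₂ (inj₂ (inj₂ (inj₂ (inj₂ (inj₁ refl))))))
  listed (5+6× 2) _ = inj₂ (inj₂ (inj₂ (inj₂ (inj₂ (inj₂ (inj₂ (inj₂ (inj₁ refl))))))))
  listed (5+6× 3) _ = inj₂ (inj₂ (inj₂ (inj₂ (inj₂ (inj₂ (inj₂ (inj₂ (inj₂ refl))))))))
  listed (5+6× suc (suc (suc (suc a)))) c = ⊥-elim (¬critical-29+6a a c)
  listed (6+6× 0) _ = inj₂ (inj₂ (inj₁ refl))
  listed (6+6× suc a) c = ⊥-elim (¬critical-12+6a a c)
  listed (7+6× 0) _ = inj₂ (inj₂ (inj₂ (inj₁ refl)))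
  listed (7+6× suc a) c = ⊥-elim (¬critical-13+6a a c)
  listed (8+6× a) c = ⊥-elim (¬critical-8+6a a c)

  critical-listed : ∀ {n} → Listed n → Critical S n
  critical-listed (inj₁ refl) = critical-3
  critical-listed (inj₂ (inj₁ refl)) = critical-5
  critical-listed (inj₂ (inj₂ (inj₁ refl))) = critical-6
  critical-listed (inj₂ (inj₂ (inj₂ (inj₁ refl)))) = critical-7
  critical-listed (inj₂ (inj₂ (inj₂ (inj₂ (inj₁ refl))))) = critical-9
  critical-listed (inj₂ (inj₂ (inj₂ (inj₂ (inj₂ (inj₁ refl)))))) = critical-10
  critical-listed (inj₂ (inj₂ (inj₂ (inj₂ (inj₂ (inj₂ (inj₁ refl))))))) = critical-11
  critical-listed (inj₂ (inj₂ (inj₂ (inj₂ (inj₂ (inj₂ (inj₂ (inj₁ refl)))))))) = critical-15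
  critical-listed (inj₂ (inj₂ (inj₂ (inj₂ (inj₂ (inj₂ (inj₂ (inj₂ (inj₁ refl))))))))) = critical-17
  critical-listed (inj₂ (inj₂ (inj₂ (inj₂ (inj₂ (inj₂ (inj₂ (inj₂ (inj₂ refl))))))))) = critical-23

  classification : ∀ n → 3 ≤ n → Critical S n ⇔ Listed n
  classification n 3≤n = mk⇔ (listed (modSix n 3≤n)) critical-listed

module PartC (S : PackingSeq) (S∈ : In𝒮 1 3 5 5 S) where
  open Common S (λ c → ≤-trans (reqA≤reqC c) (requirement≤seq S S∈ c)) (seq≤requirement S S∈)
  private
    module C = Certificates S reqC reqC (requirement≤seq S S∈) (seq≤requirement S S∈) (λ _ → ≤-refl) tt

    odd⇒not-4-colourable : ∀ r a → 6 ≤ r → r % 2 ≡ 1 → ¬ PackingColoring S (fullC (r + a * 6)) 4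
    odd⇒not-4-colourable r@(suc _) a 6≤r odd = oddCycle-not-4-colourable S (requirement≤seq S S∈)
      (≤-trans 6≤r (m≤m+n r (a * 6))) (trans (+6×-parity r a) odd)

  critical-10 : Critical S 10
  critical-10 = critical S 4 fiveColouring-10 (C.noCycle 4 refl) avoiding⇒4-colourable

  critical-11 : Critical S 11
  critical-11 = critical S 5 (cycle 6 (0 ∷ 1 ∷ 0 ∷ 2 ∷ 0 ∷ 1 ∷ 0 ∷ 3 ∷ 0 ∷ 4 ∷ 5 ∷ []) refl tt tt tt)
                  (C.noCycle 5 refl)
                  (λ H e avoids → PackingColoring-mono S H (n≤1+n 4) (avoiding⇒4-colourable H e avoids))

  critical-7+6a : ∀ a → Critical S (7 + a * 6)
  critical-7+6a a = critical S 4 (fiveColouring-7+6a a) (odd⇒not-4-colourable 7 a (n≤1+n 6) refl)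
                      avoiding⇒4-colourable

  critical-9+6a : ∀ a → Critical S (9 + a * 6)
  critical-9+6a a = critical S 4 (fiveColouring-9+6a a) (odd⇒not-4-colourable 9 a (m≤m+n 6 3) refl)
                      avoiding⇒4-colourable

  critical-17+6a : ∀ a → Critical S (17 + a * 6)
  critical-17+6a a = critical S 4 (fiveColouring-17+6a a) (odd⇒not-4-colourable 17 a (m≤m+n 6 11) refl)
                       avoiding⇒4-colourable

  Listed : ℕ → Set
  Listed n = n ≡ 6 ⊎ n ≡ 10 ⊎ n % 2 ≡ 1

  listed : ∀ {n} → ModSix n → Critical S n → Listed n
  listed (3+6× a) _ = inj₂ (inj₂ (+6×-parity 3 a))
  listed (4+6× 0) c = ⊥-elim (¬critical-4 c)
  listed (4+6× 1) _ = inj₂ (inj₁ refl)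
  listed (4+6× suc (suc a)) c = ⊥-elim (¬critical-16+6a a c)
  listed (5+6× a) _ = inj₂ (inj₂ (+6×-parity 5 a))
  listed (6+6× 0) _ = inj₁ refl
  listed (6+6× suc a) c = ⊥-elim (¬critical-12+6a a c)
  listed (7+6× a) _ = inj₂ (inj₂ (+6×-parity 7 a))
  listed (8+6× a) c = ⊥-elim (¬critical-8+6a a c)

  critical-odd : ∀ {n} → ModSix n → n % 2 ≡ 1 → Critical S n
  critical-odd (3+6× 0) _ = critical-3
  critical-odd (3+6× suc a) _ = critical-9+6a a
  critical-odd (4+6× a) odd = ⊥-elim (0≢1+n (trans (sym (+6×-parity 4 a)) odd))
  critical-odd (5+6× 0) _ = critical-5
  critical-odd (5+6× 1) _ = critical-11
  critical-odd (5+6× suc (suc a)) _ = critical-17+6a a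
  critical-odd (6+6× a) odd = ⊥-elim (0≢1+n (trans (sym (+6×-parity 6 a)) odd))
  critical-odd (7+6× a) _ = critical-7+6a a
  critical-odd (8+6× a) odd = ⊥-elim (0≢1+n (trans (sym (+6×-parity 8 a)) odd))

  classification : ∀ n → 3 ≤ n → Critical S n ⇔ Listed n
  classification n 3≤n = mk⇔ (listed (modSix n 3≤n)) critical-listed
    where
    critical-listed : Listed n → Critical S n
    critical-listed (inj₁ refl) = critical-6
    critical-listed (inj₂ (inj₁ refl)) = critical-10
    critical-listed (inj₂ (inj₂ odd)) = critical-odd (modSix n 3≤n) odd

theorem4p2 : (n : ℕ) → 3 ≤ n →
      ((S : PackingSeq) → In𝒮 1 3 4 4 S →
        (Critical S n ⇔ (n ≡ 3 ⊎ n ≡ 5 ⊎ n ≡ 6 ⊎ n ≡ 7 ⊎ n ≡ 9)))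
    × ((S : PackingSeq) → In𝒮 1 3 4 5 S →
        (Critical S n ⇔ (n ≡ 3 ⊎ n ≡ 5 ⊎ n ≡ 6 ⊎ n ≡ 7 ⊎ n ≡ 9 ⊎ n ≡ 10
                          ⊎ n ≡ 11 ⊎ n ≡ 15 ⊎ n ≡ 17 ⊎ n ≡ 23)))
    × ((S : PackingSeq) → In𝒮 1 3 5 5 S →
        (Critical S n ⇔ (n ≡ 6 ⊎ n ≡ 10 ⊎ n % 2 ≡ 1)))
theorem4p2 n 3≤n = (λ S S∈ → PartA.classification S S∈ n 3≤n)
                 , (λ S S∈ → PartB.classification S S∈ n 3≤n)
                 , (λ S S∈ → PartC.classification S S∈ n 3≤n)
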